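{- Let $k\geq 2$ and let $\lambda\vdash k$ satisfy $\lambda=\lambda^{t}$. Then $f^{\lambda}$ is even. Moreover, for every $0\leq\alpha\leq k-2$, $\operatorname{SYT}(\lambda)$ is the disjoint union of $\operatorname{SYT}_{2,\alpha}(\lambda)$ and $\{T^{t}: T\in\operatorname{SYT}_{2,\alpha}(\lambda)\}$; in particular, for every $T\in\operatorname{SYT}(\lambda)$ exactly one of $T$ and $T^{t}$ lies in $\operatorname{SYT}_{2,\alpha}(\lambda)$, and $f^{\lambda}=2f^{\lambda}_{2,\alpha}$.
   Context: For a partition $\lambda\vdash k$, its diagram has boxes $(i,j)$, $1\le i\le\ell(\lambda)$, $1\le j\le\lambda_i$. $\operatorname{SYT}(\lambda)$ is the set of standard Young tableaux of shape $\lambda$ (bijective fillings of the boxes with $1,\ldots,k$ increasing along rows and down columns), $f^\lambda=|\operatorname{SYT}(\lambda)|$. For $T\in\operatorname{SYT}(\lambda)$, $R_T(m)$ is the row of the box containing $m$. For $0\le h\le k$ and $0\le\alpha\le k-h$, $\operatorname{SYT}_{h,\alpha}(\lambda)$ is the set of $T\in\operatorname{SYT}(\lambda)$ with $R_T(i+1+\alpha)>R_T(i+\alpha)$ for all $1\le i<h$, and $f^{\lambda}_{h,\alpha}=|\operatorname{SYT}_{h,\alpha}(\lambda)|$. The transpose $\lambda^t$ is the partition whose diagram is the reflection of that of $\lambda$ in the main diagonal; for a tableau $T$ of shape $\lambda$, $T^t$ is the tableau of shape $\lambda^t$ obtained by reflecting boxes together with their entries (the entry in box $(i,j)$ of $T$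 is placed in box $(j,i)$). -}

module Defs where

open import Data.Nat using (ℕ; zero; suc; _+_; _*_; _<_; _≤_; _≥_; _<ᵇ_; _≟_)
open import Data.Nat.Divisibility using (_∣_)
open import Data.List using (List; []; _∷_; map; concat; length; upTo; filter; mapMaybe)
open import Data.Nat.ListAction using (sum)
open import Data.List.Relation.Unary.All using (All)
open import Data.List.Relation.Unary.Linked using (Linked)
open import Data.List.Relation.Unary.Unique.Propositional using (Unique)
open import Data.List.Relation.Binary.Permutation.Propositional using (_↭_)
open import Data.List.Membership.Propositional using (_∈_)
open import Data.List.Membership.DecPropositional _≟_ using (_∈?_)
open import Data.Maybe using (Maybe; just; nothing)
open import Data.Product using (_×_)
open import Data.Bool using (if_then_else_; T)
open import Relation.Nullary using (does)
open import Relation.Binary.PropositionalEquality using (_≡_)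
open import Function.Bundles using (_⇔_)

IsPartition : ℕ → List ℕ → Set
IsPartition k p = Linked _≥_ p × All (0 <_) p × sum p ≡ k

at : {A : Set} → List A → ℕ → Maybe A
at []       _       = nothing
at (x ∷ xs) zero    = just x
at (x ∷ xs) (suc i) = at xs i

head0 : List ℕ → ℕ
head0 []      = 0
head0 (x ∷ _) = x

conj : List ℕ → List ℕ
conj p = map (λ j → length (filter (λ x → j <? x) p)) (upTo (head0 p))
  where
  open import Data.Nat using (_<?_)

-- A tableau is a list of rows; row i (0-indexed) is a list of entries.
Tableau : Set
Tableau = List (List ℕ)

entry : Tableau → ℕ → ℕ → Maybe ℕ
entry t i j with at t i
... | nothing = nothing
... | just r  = at r j

IsSYT : List ℕ → Tableau → Set
IsSYT sh t =
    map length t ≡ sh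
  × concat t ↭ map suc (upTo (sum sh))
  × (∀ i j a b → entry t i j ≡ just a → entry t i (suc j) ≡ just b → a < b)
  × (∀ i j a b → entry t i j ≡ just a → entry t (suc i) j ≡ just b → a < b)

transposeT : Tableau → Tableau
transposeT t = map (λ j → mapMaybe (λ r → at r j) t) (upTo (head0 (map length t)))

-- R_T(m): (0-indexed) row of the box containing m (only meaningful if m occurs)
rowOf : Tableau → ℕ → ℕ
rowOf []      m = 0
rowOf (r ∷ t) m = if does (m ∈? r) then 0 else suc (rowOf t m)

IsSYTh : ℕ → ℕ → List ℕ → Tableau → Set
IsSYTh h α sh t =
  IsSYT sh t × (∀ i → 1 ≤ i → i < h → rowOf t (i + α) < rowOf t (suc i + α))

-- L is a duplicate-free list of exactly the tableaux satisfying P,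
-- so that |{t | P t}| = length L.
Enumerates : (Tableau → Set) → List Tableau → Set
Enumerates P L = Unique L × (∀ t → (t ∈ L) ⇔ P t)

-- In a standard Young tableau, if m + 1 lies in a lower row than m then it lies
-- in a weakly earlier column, and otherwise it lies in a strictly later column.
-- Since the rows of T^t are the columns of T, exactly one of T and T^t has
-- α + 2 in a lower row than α + 1. For λ = λ^t transposition is an involution
-- of SYT(λ), so it exchanges SYT_{2,α}(λ) with its complement in SYT(λ);
-- hence f^λ = 2 f^λ_{2,α}.
module Submission where

open import Defs
open import Data.Nat using (ℕ; zero; suc; _*_; _≤_; _∸_; _+_; _<_; z≤n; s≤s; _≥_)
open import Data.Nat.Properties
open import Data.Nat.Divisibility using (_∣_; divides)
open import Data.Nat.ListAction using (sum)
open import Data.List using (List; []; _∷_; length; map; concat; upTo; filter; drop; _++_; applyUpTo; mapMaybe)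
open import Data.List.Properties using (map-cong; map-∘; map-upTo; length-map; length-++; ∷-injective; filter-accept; filter-reject)
open import Data.List.Relation.Unary.All as All using (All; []; _∷_)
import Data.List.Relation.Unary.All.Properties as All
open import Data.List.Relation.Unary.Any using (here; there)
open import Data.List.Relation.Unary.Linked using (Linked; []; _∷_)
open import Data.List.Relation.Unary.Linked.Properties using (Linked⇒All)
open import Data.List.Relation.Unary.Unique.Propositional using (Unique; []; _∷_)
import Data.List.Relation.Unary.Unique.Propositional.Properties as Unique
open import Data.List.Membership.Propositional using (_∈_)
open import Data.List.Membership.Propositional.Properties using (∈-++⁺ˡ; ∈-++⁺ʳ; ∈-++⁻; ∈-map⁺; ∈-map⁻; ∈-upTo⁺; ∈-filter⁺; ∈-filter⁻)
open import Data.List.Membership.Propositional.Properties.WithK using (unique∧set⇒bag)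
open import Data.List.Membership.DecPropositional _≟_ using (_∈?_)
open import Data.List.Relation.Binary.BagAndSetEquality using (∼bag⇒↭)
open import Data.List.Relation.Binary.Permutation.Propositional using (_↭_; ↭-refl; ↭-sym; ↭-trans; ↭-prep; ↭-reflexive; ↭⇒↭ₛ)
open import Data.List.Relation.Binary.Permutation.Propositional.Properties using (∈-resp-↭; ↭-length; ++⁺ˡ; shifts)
import Data.List.Relation.Binary.Permutation.Setoid.Properties as Permutationₛ
open import Data.Maybe using (Maybe; just; nothing)
import Data.Maybe as Maybe
open import Data.Maybe.Properties using (just-injective)
open import Data.Product using (_×_; ∃; _,_; proj₁; proj₂)
open import Data.Sum using (_⊎_; inj₁; inj₂)
open import Data.Empty using (⊥; ⊥-elim)
open import Function using (_∘_; id)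
open import Function.Bundles using (_⇔_; mk⇔; Equivalence)
open import Relation.Nullary using (¬_; Dec; yes; no)
open import Relation.Binary.PropositionalEquality using (_≡_; refl; sym; trans; cong; cong₂; subst; setoid; module ≡-Reasoning)

open Equivalence using (to; from)

module _ {A : Set} where

  at-just⇒∈ : ∀ (r : List A) j {x} → at r j ≡ just x → x ∈ r
  at-just⇒∈ (y ∷ r) zero    refl = here refl
  at-just⇒∈ (y ∷ r) (suc j) e    = there (at-just⇒∈ r j e)

  ∈⇒at-just : ∀ {r : List A} {x} → x ∈ r → ∃ λ j → at r j ≡ just x
  ∈⇒at-just (here refl) = 0 , refl
  ∈⇒at-just (there x∈r) with j , e ← ∈⇒at-just x∈r = suc j , e

  at-just⇒< : ∀ (r : List A) j {x} → at r j ≡ just x → j < length r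
  at-just⇒< (y ∷ r) zero    e = s≤s z≤n
  at-just⇒< (y ∷ r) (suc j) e = s≤s (at-just⇒< r j e)

  <⇒at-just : ∀ (r : List A) j → j < length r → ∃ λ x → at r j ≡ just x
  <⇒at-just (y ∷ r) zero    _         = y , refl
  <⇒at-just (y ∷ r) (suc j) (s≤s j<r) = <⇒at-just r j j<r

  ≤⇒at-nothing : ∀ (r : List A) j → length r ≤ j → at r j ≡ nothing
  ≤⇒at-nothing []      j       _         = refl
  ≤⇒at-nothing (y ∷ r) (suc j) (s≤s r≤j) = ≤⇒at-nothing r j r≤j

  at-nothing⇒≤ : ∀ (r : List A) j → at r j ≡ nothing → length r ≤ j
  at-nothing⇒≤ []      j       _ = z≤n
  at-nothing⇒≤ (y ∷ r) zero    ()
  at-nothing⇒≤ (y ∷ r) (suc j) e = s≤s (at-nothing⇒≤ r j e)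

  at-extensional : ∀ (r r′ : List A) → (∀ j → at r j ≡ at r′ j) → r ≡ r′
  at-extensional []      []       _ = refl
  at-extensional []      (_ ∷ _)  f with () ← f 0
  at-extensional (_ ∷ _) []       f with () ← f 0
  at-extensional (x ∷ r) (y ∷ r′) f =
    cong₂ _∷_ (just-injective (f 0)) (at-extensional r r′ (f ∘ suc))

  at-applyUpTo-< : ∀ (g : ℕ → A) n i → i < n → at (applyUpTo g n) i ≡ just (g i)
  at-applyUpTo-< g (suc n) zero    _         = refl
  at-applyUpTo-< g (suc n) (suc i) (s≤s i<n) = at-applyUpTo-< (g ∘ suc) n i i<n

  at-applyUpTo-≥ : ∀ (g : ℕ → A) n i → n ≤ i → at (applyUpTo g n) i ≡ nothing
  at-applyUpTo-≥ g zero    i       _         = refl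
  at-applyUpTo-≥ g (suc n) (suc i) (s≤s n≤i) = at-applyUpTo-≥ (g ∘ suc) n i n≤i

  at-drop-1 : ∀ (r : List A) j → at (drop 1 r) j ≡ at r (suc j)
  at-drop-1 []      j = refl
  at-drop-1 (x ∷ r) j = refl

at-map : ∀ {A B : Set} (f : A → B) (xs : List A) i → at (map f xs) i ≡ Maybe.map f (at xs i)
at-map f []       i       = refl
at-map f (x ∷ xs) zero    = refl
at-map f (x ∷ xs) (suc i) = at-map f xs i

module _ {A : Set} where

  Unique-++⁻ʳ : ∀ (xs : List A) {ys} → Unique (xs ++ ys) → Unique ys
  Unique-++⁻ʳ []       u       = u
  Unique-++⁻ʳ (x ∷ xs) (_ ∷ u) = Unique-++⁻ʳ xs u

  Unique-++⇒∉ : ∀ (xs : List A) {ys m} → Unique (xs ++ ys) → m ∈ xs → m ∈ ys → ⊥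
  Unique-++⇒∉ (x ∷ xs) (x∉ ∷ _) (here refl) m∈ys = All.lookup x∉ (∈-++⁺ʳ xs m∈ys) refl
  Unique-++⇒∉ (x ∷ xs) (_ ∷ u)  (there m∈xs) m∈ys = Unique-++⇒∉ xs u m∈xs m∈ys

  Unique-resp-↭ : ∀ {xs ys : List A} → xs ↭ ys → Unique xs → Unique ys
  Unique-resp-↭ p = Permutationₛ.Unique-resp-↭ (setoid A) (↭⇒↭ₛ p)

  length-unique-≐ : ∀ {xs ys : List A} → Unique xs → Unique ys →
    (∀ {z} → z ∈ xs ⇔ z ∈ ys) → length xs ≡ length ys
  length-unique-≐ ux uy xs≐ys = ↭-length (∼bag⇒↭ (unique∧set⇒bag ux uy xs≐ys))

Unique-map⁺-on : ∀ {A B : Set} (f : A → B) {xs : List A} → Unique xs →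
  (∀ {x y} → x ∈ xs → y ∈ xs → f x ≡ f y → x ≡ y) → Unique (map f xs)
Unique-map⁺-on f []             _   = []
Unique-map⁺-on f (x∉xs ∷ u) inj =
  All.map⁺ (All.tabulate λ y∈xs fx≡fy → All.lookup x∉xs y∈xs (inj (here refl) (there y∈xs) fx≡fy))
  ∷ Unique-map⁺-on f u (λ x∈ y∈ → inj (there x∈) (there y∈))

entry-row : ∀ (t : Tableau) i {r} j → at t i ≡ just r → entry t i j ≡ at r j
entry-row (_ ∷ t) zero    j refl = refl
entry-row (_ ∷ t) (suc i) j e    = entry-row t i j e

entry-no-row : ∀ (t : Tableau) i j → at t i ≡ nothing → entry t i j ≡ nothing
entry-no-row []      i       j _ = refl
entry-no-row (_ ∷ t) (suc i) j e = entry-no-row t i j e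

entry⇒∈-concat : ∀ (t : Tableau) i j {m} → entry t i j ≡ just m → m ∈ concat t
entry⇒∈-concat (r ∷ t) zero    j e = ∈-++⁺ˡ (at-just⇒∈ r j e)
entry⇒∈-concat (r ∷ t) (suc i) j e = ∈-++⁺ʳ r (entry⇒∈-concat t i j e)

∈-concat⇒entry : ∀ (t : Tableau) {m} → m ∈ concat t → ∃ λ i → ∃ λ j → entry t i j ≡ just m
∈-concat⇒entry (r ∷ t) m∈ with ∈-++⁻ r m∈
... | inj₁ m∈r with j , e ← ∈⇒at-just m∈r = 0 , j , e
... | inj₂ m∈t with i , j , e ← ∈-concat⇒entry t m∈t = suc i , j , e

entry-extensional : ∀ (t t′ : Tableau) → map length t ≡ map length t′ →
  (∀ i j → entry t i j ≡ entry t′ i j) → t ≡ t′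
entry-extensional []      []       _  _ = refl
entry-extensional (r ∷ t) (r′ ∷ t′) eq f =
  cong₂ _∷_ (at-extensional r r′ (f 0)) (entry-extensional t t′ (proj₂ (∷-injective eq)) (f ∘ suc))

entry-beyond-width : ∀ (t : Tableau) i j → All (λ r → length r ≤ j) t → entry t i j ≡ nothing
entry-beyond-width []      i       j _          = refl
entry-beyond-width (r ∷ t) zero    j (r≤j ∷ _)  = ≤⇒at-nothing r j r≤j
entry-beyond-width (r ∷ t) (suc i) j (_ ∷ t≤j)  = entry-beyond-width t i j t≤j

rowOf-entry : ∀ (t : Tableau) → Unique (concat t) → ∀ i j {m} → entry t i j ≡ just m → rowOf t m ≡ i
rowOf-entry (r ∷ t) u zero j {m} e with m ∈? r
... | yes _    = refl
... | no  m∉r  = ⊥-elim (m∉r (at-just⇒∈ r j e))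
rowOf-entry (r ∷ t) u (suc i) j {m} e with m ∈? r
... | yes m∈r  = ⊥-elim (Unique-++⇒∉ r u m∈r (entry⇒∈-concat t i j e))
... | no  _    = cong suc (rowOf-entry t (Unique-++⁻ʳ r u) i j e)

RowsDecreasing : Tableau → Set
RowsDecreasing t = Linked _≥_ (map length t)

RowsDecreasing-tail : ∀ {r t} → RowsDecreasing (r ∷ t) → RowsDecreasing t
RowsDecreasing-tail {t = []}    _       = []
RowsDecreasing-tail {t = _ ∷ _} (_ ∷ d) = d

rows-≤-first : ∀ {r t} → RowsDecreasing (r ∷ t) → All (λ r′ → length r′ ≤ length r) t
rows-≤-first {t = []}    _       = []
rows-≤-first {t = _ ∷ _} (p ∷ d) = All.map⁻ (Linked⇒All (λ p q → ≤-trans q p) p d)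

rows-≤-width : ∀ (t : Tableau) → RowsDecreasing t → All (λ r → length r ≤ head0 (map length t)) t
rows-≤-width []      _ = []
rows-≤-width (r ∷ t) d = ≤-refl ∷ rows-≤-first {r} {t} d

entry-above : ∀ (t : Tableau) → RowsDecreasing t → ∀ i j {b} →
  entry t (suc i) j ≡ just b → ∃ λ a → entry t i j ≡ just a
entry-above (r ∷ r′ ∷ t) (r≥r′ ∷ _) zero    j e = <⇒at-just r j (<-≤-trans (at-just⇒< r′ j e) r≥r′)
entry-above (r ∷ r′ ∷ t) (_ ∷ d)    (suc i) j e = entry-above (r′ ∷ t) d i j e

entry-left : ∀ (t : Tableau) i j {b} → entry t i (suc j) ≡ just b → ∃ λ a → entry t i j ≡ just a
entry-left (r ∷ t) zero    j e = <⇒at-just r j (<-trans (n<1+n j) (at-just⇒< r (suc j) e))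
entry-left (r ∷ t) (suc i) j e = entry-left t i j e

downward-closed : (P : ℕ → Set) → (∀ n → P (suc n) → P n) → ∀ {m n} → m ≤ n → P n → P m
downward-closed P step {n = zero}  z≤n p = p
downward-closed P step {n = suc n} m≤n p with m≤n⇒m<n∨m≡n m≤n
... | inj₁ (s≤s m≤n′) = downward-closed P step m≤n′ (step n p)
... | inj₂ refl       = p

entry-north-west : ∀ (t : Tableau) → RowsDecreasing t → ∀ {i j i′ j′ b} →
  entry t i j ≡ just b → i′ ≤ i → j′ ≤ j → ∃ λ a → entry t i′ j′ ≡ just a
entry-north-west t d {j = j} {i′} {b = b} e i′≤i j′≤j =
  downward-closed (λ n → ∃ λ a → entry t i′ n ≡ just a) (λ n (_ , e′) → entry-left t i′ n e′) j′≤j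
    (downward-closed (λ n → ∃ λ a → entry t n j ≡ just a) (λ n (_ , e′) → entry-above t d n j e′) i′≤i
      (b , e))

IncreasingLine : (ℕ → Maybe ℕ) → Set
IncreasingLine E = (∀ n a b → E n ≡ just a → E (suc n) ≡ just b → a < b)
                 × (∀ n {b} → E (suc n) ≡ just b → ∃ λ a → E n ≡ just a)

line-< : ∀ {E} → IncreasingLine E → ∀ {m n a b} → E m ≡ just a → E n ≡ just b → m < n → a < b
line-< inc@(step , defined) {m} {suc n} ea eb (s≤s m≤n) with m≤n⇒m<n∨m≡n m≤n
... | inj₂ refl = step m _ _ ea eb
... | inj₁ m<n with c , ec ← defined n eb = <-trans (line-< inc ea ec m<n) (step n _ _ ec eb)

line-≤ : ∀ {E} → IncreasingLine E → ∀ {m n a b} → E m ≡ just a → E n ≡ just b → m ≤ n → a ≤ b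
line-≤ inc ea eb m≤n with m≤n⇒m<n∨m≡n m≤n
... | inj₁ m<n  = <⇒≤ (line-< inc ea eb m<n)
... | inj₂ refl = ≤-reflexive (just-injective (trans (sym ea) eb))

RowsIncreasing ColumnsIncreasing : Tableau → Set
RowsIncreasing    t = ∀ i j a b → entry t i j ≡ just a → entry t i (suc j) ≡ just b → a < b
ColumnsIncreasing t = ∀ i j a b → entry t i j ≡ just a → entry t (suc i) j ≡ just b → a < b

module StandardFilling {t : Tableau} (d : RowsDecreasing t)
                       (rows : RowsIncreasing t) (columns : ColumnsIncreasing t) where

  row-line : ∀ i → IncreasingLine (entry t i)
  row-line i = rows i , entry-left t i

  column-line : ∀ j → IncreasingLine (λ i → entry t i j)
  column-line j = (λ i → columns i j) , (λ i → entry-above t d i j)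

  -- The entry e at (i, j′) would satisfy a < e < a + 1.
  lower⇒weakly-left : ∀ {i j i′ j′ a} → entry t i j ≡ just a → entry t i′ j′ ≡ just (suc a) →
    i < i′ → j′ ≤ j
  lower⇒weakly-left {i} {j} {i′} {j′} ea eb i<i′ with j′ ≤? j
  ... | yes j′≤j = j′≤j
  ... | no  j′≰j with e , ee ← entry-north-west t d eb (<⇒≤ i<i′) (≤-refl {j′}) =
    ⊥-elim (<⇒≱ (line-< (row-line i) ea ee (≰⇒> j′≰j)) (≤-pred (line-< (column-line j′) ee eb i<i′)))

  -- The entry e at (i′, j) would satisfy a + 1 ≤ e ≤ a.
  weakly-higher⇒right : ∀ {i j i′ j′ a} → entry t i j ≡ just a → entry t i′ j′ ≡ just (suc a) →
    i′ ≤ i → j < j′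
  weakly-higher⇒right {i} {j} {i′} {j′} ea eb i′≤i with j <? j′
  ... | yes j<j′ = j<j′
  ... | no  j≮j′ with e , ee ← entry-north-west t d ea i′≤i (≤-refl {j}) =
    ⊥-elim (<-irrefl refl (≤-trans (line-≤ (row-line i′) eb ee (≮⇒≥ j≮j′))
                                   (line-≤ (column-line j) ee ea i′≤i)))

  successor-lower-xor-right : ∀ {i j i′ j′ a} → entry t i j ≡ just a → entry t i′ j′ ≡ just (suc a) →
    (i < i′ × ¬ j < j′) ⊎ (¬ i < i′ × j < j′)
  successor-lower-xor-right {i = i} {i′ = i′} ea eb with i <? i′
  ... | yes i<i′ = inj₁ (i<i′ , ≤⇒≯ (lower⇒weakly-left ea eb i<i′))
  ... | no  i≮i′ = inj₂ (i≮i′ , weakly-higher⇒right ea eb (≮⇒≥ i≮i′))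

-- Transposition

column : Tableau → ℕ → List ℕ
column t j = mapMaybe (λ r → at r j) t

column-beyond-width : ∀ (t : Tableau) j → All (λ r → length r ≤ j) t → column t j ≡ []
column-beyond-width []      j _           = refl
column-beyond-width (r ∷ t) j (r≤j ∷ t≤j) rewrite ≤⇒at-nothing r j r≤j = column-beyond-width t j t≤j

rows-beyond-missing : ∀ {r t j} → RowsDecreasing (r ∷ t) → at r j ≡ nothing → All (λ r′ → length r′ ≤ j) t
rows-beyond-missing {r} {t} {j} d e = All.map (λ p → ≤-trans p (at-nothing⇒≤ r j e)) (rows-≤-first {r} {t} d)

at-column : ∀ (t : Tableau) → RowsDecreasing t → ∀ j i → at (column t j) i ≡ entry t i j
at-column []      _ j i = refl
at-column (r ∷ t) d j i with at r j in e
... | just x with i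
...   | zero  = sym e
...   | suc i = at-column t (RowsDecreasing-tail {r} {t} d) j i
at-column (r ∷ t) d j i | nothing =
  trans (cong (λ c → at c i) (column-beyond-width t j t≤j))
        (sym (entry-beyond-width (r ∷ t) i j (at-nothing⇒≤ r j e ∷ t≤j)))
  where t≤j = rows-beyond-missing {r} {t} d e

entry-transposeT : ∀ (t : Tableau) → RowsDecreasing t → ∀ i j → entry (transposeT t) i j ≡ entry t j i
entry-transposeT t d i j with i <? head0 (map length t)
... | yes i<w = trans (entry-row (transposeT t) i j column-i) (at-column t d i j)
  where
  column-i : at (transposeT t) i ≡ just (column t i)
  column-i = trans (at-map (column t) (upTo (head0 (map length t))) i)
                   (cong (Maybe.map (column t)) (at-applyUpTo-< id _ i i<w))
... | no i≮w = trans (entry-no-row (transposeT t) i j no-row)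
                     (sym (entry-beyond-width t j i (All.map (λ p → ≤-trans p (≮⇒≥ i≮w)) (rows-≤-width t d))))
  where
  no-row : at (transposeT t) i ≡ nothing
  no-row = trans (at-map (column t) (upTo (head0 (map length t))) i)
                 (cong (Maybe.map (column t)) (at-applyUpTo-≥ id _ i (≮⇒≥ i≮w)))

length-column : ∀ (t : Tableau) j → length (column t j) ≡ length (filter (j <?_) (map length t))
length-column []      j = refl
length-column (r ∷ t) j with j <? length r
... | yes j<r rewrite proj₂ (<⇒at-just r j j<r) | filter-accept (j <?_) {xs = map length t} j<r =
  cong suc (length-column t j)
... | no  j≮r rewrite ≤⇒at-nothing r j (≮⇒≥ j≮r) | filter-reject (j <?_) {xs = map length t} j≮r =
  length-column t j

shape-transposeT : ∀ (t : Tableau) → map length (transposeT t) ≡ conj (map length t)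
shape-transposeT t =
  trans (sym (map-∘ (upTo (head0 (map length t))))) (map-cong (length-column t) (upTo (head0 (map length t))))

concat≡first-column++rest : ∀ (t : Tableau) → concat t ↭ column t 0 ++ concat (map (drop 1) t)
concat≡first-column++rest []            = ↭-refl
concat≡first-column++rest ([] ∷ t)      = concat≡first-column++rest t
concat≡first-column++rest ((x ∷ r) ∷ t) =
  ↭-prep x (↭-trans (++⁺ˡ r (concat≡first-column++rest t)) (shifts r (column t 0)))

column-drop-1 : ∀ (t : Tableau) j → column (map (drop 1) t) j ≡ column t (suc j)
column-drop-1 []      j = refl
column-drop-1 (r ∷ t) j rewrite at-drop-1 r j | column-drop-1 t j = refl

concat-columns : ∀ n (t : Tableau) → All (λ r → length r ≤ n) t → concat (map (column t) (upTo n)) ↭ concat t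
concat-columns zero    t t≤0 = ↭-reflexive (sym (concat-empty t t≤0))
  where
  concat-empty : ∀ (t : Tableau) → All (λ r → length r ≤ 0) t → concat t ≡ []
  concat-empty []       _        = refl
  concat-empty ([] ∷ t) (_ ∷ t≤0) = concat-empty t t≤0
concat-columns (suc n) t t≤n+1 =
  ↭-trans (↭-reflexive (cong (λ cs → column t 0 ++ concat cs) later-columns))
    (↭-trans (++⁺ˡ (column t 0) (concat-columns n (map (drop 1) t) rest≤n))
      (↭-sym (concat≡first-column++rest t)))
  where
  rest≤n : All (λ r → length r ≤ n) (map (drop 1) t)
  rest≤n = All.map⁺ (All.map (λ {r} → drop-1-≤ r) t≤n+1)
    where
    drop-1-≤ : ∀ (r : List ℕ) → length r ≤ suc n → length (drop 1 r) ≤ n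
    drop-1-≤ []      _         = z≤n
    drop-1-≤ (_ ∷ r) (s≤s r≤n) = r≤n
  open ≡-Reasoning
  later-columns : map (column t) (applyUpTo suc n) ≡ map (column (map (drop 1) t)) (upTo n)
  later-columns = begin
    map (column t) (applyUpTo suc n)            ≡⟨ cong (map (column t)) (sym (map-upTo suc n)) ⟩
    map (column t) (map suc (upTo n))           ≡⟨ sym (map-∘ (upTo n)) ⟩
    map (column t ∘ suc) (upTo n)               ≡⟨ map-cong (λ j → sym (column-drop-1 t j)) (upTo n) ⟩
    map (column (map (drop 1) t)) (upTo n)      ∎

concat-transposeT : ∀ (t : Tableau) → RowsDecreasing t → concat (transposeT t) ↭ concat t
concat-transposeT t d = concat-columns (head0 (map length t)) t (rows-≤-width t d)

-- Descents of standard Young tableaux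

IsDescent : Tableau → ℕ → Set
IsDescent t m = rowOf t m < rowOf t (suc m)

IsDescent? : ∀ t m → Dec (IsDescent t m)
IsDescent? t m = rowOf t m <? rowOf t (suc m)

IsSYTh-2⇔ : ∀ {α sh t} → IsSYTh 2 α sh t ⇔ (IsSYT sh t × IsDescent t (suc α))
IsSYTh-2⇔ = mk⇔ (λ (s , desc) → s , desc 1 (s≤s z≤n) (s≤s (s≤s z≤n)))
                (λ (s , desc) → s , λ { (suc zero) _ _ → desc ; (suc (suc _)) _ (s≤s (s≤s ())) })

module StandardTableaux {sh : List ℕ} (sh-decreasing : Linked _≥_ sh) where

  SYT⇒RowsDecreasing : ∀ {t} → IsSYT sh t → RowsDecreasing t
  SYT⇒RowsDecreasing (shape , _) = subst (Linked _≥_) (sym shape) sh-decreasing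

  SYT⇒Unique : ∀ {t} → IsSYT sh t → Unique (concat t)
  SYT⇒Unique (_ , perm , _) =
    Unique-resp-↭ (↭-sym perm) (Unique.map⁺ suc-injective (Unique.upTo⁺ (sum sh)))

  SYT-entry : ∀ {t} → IsSYT sh t → ∀ m → m < sum sh → ∃ λ i → ∃ λ j → entry t i j ≡ just (suc m)
  SYT-entry {t} (_ , perm , _) m m<k =
    ∈-concat⇒entry t (∈-resp-↭ (↭-sym perm) (∈-map⁺ suc (∈-upTo⁺ m<k)))

  rowOf-SYT : ∀ {t} → IsSYT sh t → ∀ {i j m} → entry t i j ≡ just m → rowOf t m ≡ i
  rowOf-SYT {t} s {i} {j} = rowOf-entry t (SYT⇒Unique s) i j

  rowOf-transposeT-SYT : ∀ {t} → IsSYT sh t → ∀ {i j m} → entry t i j ≡ just m → rowOf (transposeT t) m ≡ j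
  rowOf-transposeT-SYT {t} s {i} {j} e =
    rowOf-entry (transposeT t) (Unique-resp-↭ (↭-sym (concat-transposeT t d)) (SYT⇒Unique s)) j i
      (trans (entry-transposeT t d j i) e)
    where d = SYT⇒RowsDecreasing s

  descent-xor-transposed-descent : ∀ {t} → IsSYT sh t → ∀ {n} → suc n < sum sh →
    (IsDescent t (suc n) × ¬ IsDescent (transposeT t) (suc n))
    ⊎ (¬ IsDescent t (suc n) × IsDescent (transposeT t) (suc n))
  descent-xor-transposed-descent s@(_ , _ , rows , columns) {n} n+1<k
    with _ , _ , ea ← SYT-entry s n (<-trans (n<1+n n) n+1<k)
       | _ , _ , eb ← SYT-entry s (suc n) n+1<k
    -- Matching on refl identifies the positions with the rows of suc n and
    -- suc (suc n) in t and in its transpose.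
    with refl ← rowOf-SYT s ea | refl ← rowOf-SYT s eb
       | refl ← rowOf-transposeT-SYT s ea | refl ← rowOf-transposeT-SYT s eb
    = StandardFilling.successor-lower-xor-right (SYT⇒RowsDecreasing s) rows columns ea eb

-- Involutions exchanging a subset with its complement

module ComplementSwappingInvolution {A : Set} {P Q : A → Set} (σ : A → A)
  (σ-closed : ∀ {x} → P x → P (σ x))
  (σ-involutive : ∀ {x} → P x → σ (σ x) ≡ x)
  (Q⇒P : ∀ {x} → Q x → P x)
  (exactly-one : ∀ {x} → P x → (Q x × ¬ Q (σ x)) ⊎ (¬ Q x × Q (σ x))) where

  P⇔Q⊎σ[Q] : ∀ x → P x ⇔ (Q x ⊎ ∃ λ u → Q u × x ≡ σ u)
  P⇔Q⊎σ[Q] x = mk⇔ split join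
    where
    split : P x → Q x ⊎ ∃ λ u → Q u × x ≡ σ u
    split p with exactly-one p
    ... | inj₁ (qx , _)  = inj₁ qx
    ... | inj₂ (_ , qσx) = inj₂ (σ x , qσx , sym (σ-involutive p))
    join : Q x ⊎ (∃ λ u → Q u × x ≡ σ u) → P x
    join (inj₁ qx)             = Q⇒P qx
    join (inj₂ (_ , qu , refl)) = σ-closed (Q⇒P qu)

  Q⇒∉σ[Q] : ∀ x → Q x → ¬ ∃ λ u → Q u × x ≡ σ u
  Q⇒∉σ[Q] _ qσu (u , qu , refl) with exactly-one (Q⇒P qu)
  ... | inj₁ (_ , ¬qσu) = ¬qσu qσu
  ... | inj₂ (¬qu , _)  = ¬qu qu

  length≡2*length : ∀ {L L₂ : List A} →
    Unique L × (∀ x → x ∈ L ⇔ P x) → Unique L₂ × (∀ x → x ∈ L₂ ⇔ Q x) →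
    length L ≡ 2 * length L₂
  length≡2*length {L} {L₂} (uL , L≐P) (uL₂ , L₂≐Q) = begin
    length L                       ≡⟨ length-unique-≐ uL uL₂++σL₂ L≐L₂++σL₂ ⟩
    length (L₂ ++ map σ L₂)        ≡⟨ length-++ L₂ ⟩
    length L₂ + length (map σ L₂)  ≡⟨ cong (length L₂ +_) (length-map σ L₂) ⟩
    length L₂ + length L₂          ≡⟨ cong (length L₂ +_) (sym (+-identityʳ _)) ⟩
    2 * length L₂                  ∎
    where
    open ≡-Reasoning
    P-L₂ : ∀ {x} → x ∈ L₂ → P x
    P-L₂ {x} x∈ = Q⇒P (to (L₂≐Q x) x∈)
    σ-injective-on-L₂ : ∀ {x y} → x ∈ L₂ → y ∈ L₂ → σ x ≡ σ y → x ≡ y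
    σ-injective-on-L₂ x∈ y∈ σx≡σy =
      trans (sym (σ-involutive (P-L₂ x∈))) (trans (cong σ σx≡σy) (σ-involutive (P-L₂ y∈)))
    uL₂++σL₂ : Unique (L₂ ++ map σ L₂)
    uL₂++σL₂ = Unique.++⁺ uL₂ (Unique-map⁺-on σ uL₂ σ-injective-on-L₂) λ (x∈ , x∈σL₂) →
      let (u , u∈ , x≡σu) = ∈-map⁻ σ x∈σL₂
      in Q⇒∉σ[Q] _ (to (L₂≐Q _) x∈) (u , to (L₂≐Q u) u∈ , x≡σu)
    L≐L₂++σL₂ : ∀ {x} → x ∈ L ⇔ x ∈ L₂ ++ map σ L₂
    L≐L₂++σL₂ {x} = mk⇔ into back
      where
      into : x ∈ L → x ∈ L₂ ++ map σ L₂
      into x∈ with to (P⇔Q⊎σ[Q] x) (to (L≐P x) x∈)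
      ... | inj₁ qx                = ∈-++⁺ˡ (from (L₂≐Q x) qx)
      ... | inj₂ (u , qu , refl)   = ∈-++⁺ʳ L₂ (∈-map⁺ σ (from (L₂≐Q u) qu))
      back : x ∈ L₂ ++ map σ L₂ → x ∈ L
      back x∈ with ∈-++⁻ L₂ x∈
      ... | inj₁ x∈L₂ = from (L≐P x) (P-L₂ x∈L₂)
      ... | inj₂ x∈σL₂ with u , u∈ , refl ← ∈-map⁻ σ x∈σL₂ = from (L≐P x) (σ-closed (P-L₂ u∈))

  even-length : ∀ {D : A → Set} → (∀ x → Dec (D x)) → (∀ x → Q x ⇔ (P x × D x)) →
    ∀ {L} → Unique L × (∀ x → x ∈ L ⇔ P x) → 2 ∣ length L
  even-length D? Q⇔P×D {L} enum@(uL , L≐P) =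
    divides (length L₂) (trans (length≡2*length enum (Unique.filter⁺ D? uL , L₂≐Q)) (*-comm 2 (length L₂)))
    where
    L₂ = filter D? L
    L₂≐Q : ∀ x → x ∈ L₂ ⇔ Q x
    L₂≐Q x = mk⇔ (λ x∈ → let (x∈L , dx) = ∈-filter⁻ D? x∈ in from (Q⇔P×D x) (to (L≐P x) x∈L , dx))
                 (λ qx → let (px , dx) = to (Q⇔P×D x) qx in ∈-filter⁺ D? (from (L≐P x) px) dx)

module SelfConjugate {k sh} (part : IsPartition k sh) (self-conjugate : conj sh ≡ sh) where

  open StandardTableaux (proj₁ part)

  transposeT-SYT : ∀ {t} → IsSYT sh t → IsSYT sh (transposeT t)
  transposeT-SYT {t} s@(shape , perm , rows , columns) =
      trans (shape-transposeT t) (trans (cong conj shape) self-conjugate)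
    , ↭-trans (concat-transposeT t d) perm
    , (λ i j a b ea eb → columns j i a b (swap ea) (swap eb))
    , (λ i j a b ea eb → rows j i a b (swap ea) (swap eb))
    where
    d = SYT⇒RowsDecreasing s
    swap : ∀ {i j a} → entry (transposeT t) i j ≡ just a → entry t j i ≡ just a
    swap {i} {j} = trans (sym (entry-transposeT t d i j))

  transposeT-involutive : ∀ {t} → IsSYT sh t → transposeT (transposeT t) ≡ t
  transposeT-involutive {t} s =
    entry-extensional (transposeT u) t (trans (proj₁ (transposeT-SYT su)) (sym (proj₁ s)))
      λ i j → trans (entry-transposeT u (SYT⇒RowsDecreasing su) i j)
                    (entry-transposeT t (SYT⇒RowsDecreasing s) j i)
    where
    u = transposeT t
    su = transposeT-SYT s

  SYTh-2-xor-transposed : ∀ {α} → suc α < k → ∀ {t} → IsSYT sh t →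
    (IsSYTh 2 α sh t × ¬ IsSYTh 2 α sh (transposeT t))
    ⊎ (¬ IsSYTh 2 α sh t × IsSYTh 2 α sh (transposeT t))
  SYTh-2-xor-transposed α+1<k s
    with descent-xor-transposed-descent s (subst (_ <_) (sym (proj₂ (proj₂ part))) α+1<k)
  ... | inj₁ (desc , ¬desc′) = inj₁ (from IsSYTh-2⇔ (s , desc) , ¬desc′ ∘ proj₂ ∘ to IsSYTh-2⇔)
  ... | inj₂ (¬desc , desc′) = inj₂ (¬desc ∘ proj₂ ∘ to IsSYTh-2⇔ , from IsSYTh-2⇔ (transposeT-SYT s , desc′))

  module Splitting {α} (α+1<k : suc α < k) =
    ComplementSwappingInvolution transposeT transposeT-SYT transposeT-involutive
      (proj₁ ∘ to IsSYTh-2⇔) (SYTh-2-xor-transposed α+1<k)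

corollary3p4 : (k : ℕ) → 2 ≤ k → (sh : List ℕ) → IsPartition k sh → conj sh ≡ sh →
    ((L : List Tableau) → Enumerates (IsSYT sh) L → 2 ∣ length L)
    × ((α : ℕ) → α ≤ k ∸ 2 →
        ((t : Tableau) →
          IsSYT sh t ⇔ (IsSYTh 2 α sh t ⊎ ∃ (λ u → IsSYTh 2 α sh u × t ≡ transposeT u)))
      × ((t : Tableau) →
          IsSYTh 2 α sh t → ¬ ∃ (λ u → IsSYTh 2 α sh u × t ≡ transposeT u))
      × ((t : Tableau) → IsSYT sh t →
          (IsSYTh 2 α sh t × ¬ IsSYTh 2 α sh (transposeT t))
          ⊎ (¬ IsSYTh 2 α sh t × IsSYTh 2 α sh (transposeT t)))
      × ((L L₂ : List Tableau) → Enumerates (IsSYT sh) L → Enumerates (IsSYTh 2 α sh) L₂ →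
          length L ≡ 2 * length L₂))
corollary3p4 (suc (suc k)) (s≤s (s≤s z≤n)) sh part self-conjugate =
    (λ L → Splitting.even-length (s≤s (s≤s z≤n)) (λ t → IsDescent? t 1) (λ _ → IsSYTh-2⇔))
  , λ α α≤k → let open Splitting (s≤s (s≤s α≤k)) in
      P⇔Q⊎σ[Q] , Q⇒∉σ[Q] , (λ _ → SYTh-2-xor-transposed (s≤s (s≤s α≤k))) , (λ _ _ → length≡2*length)
  where open SelfConjugate part self-conjugate
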